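{- For every positive integer $n$ with prime factorization $n = p_1^{\alpha_1} p_2^{\alpha_2} \cdots p_m^{\alpha_m}$, $$rb(\mathbb{Z}_n,1) = 2+\sum_{i=1}^{m} \alpha_i\big(rb(\mathbb{Z}_{p_i},1)-2\big).$$
   Context: $\mathbb{Z}_n$ denotes the cyclic group of order $n$. An $r$-coloring of $\mathbb{Z}_n$ is a surjective map $c:\mathbb{Z}_n\to\{1,\dots,r\}$. For a fixed integer $k$, a triple is any $(x_1,x_2,x_3)\in\mathbb{Z}_n^3$ with $x_1+x_2\equiv kx_3 \pmod n$. A triple is rainbow under $c$ if $c(x_1),c(x_2),c(x_3)$ are pairwise distinct; $c$ is rainbow-free if no triple is rainbow. The rainbow number $rb(\mathbb{Z}_n,k)$ is the smallest positive integer $r$ such that every $r$-coloring of $\mathbb{Z}_n$ admits a rainbow triple (by convention $rb(\mathbb{Z}_n,k)=n+1$ if no such $r$ exists). -}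

module Defs where

open import Data.Nat as ℕ using (ℕ; zero; suc; _≤_; _<_; _^_)
open import Data.Nat.Primality using (Prime)
open import Data.Integer as ℤ using (ℤ; +_)
open import Data.Integer.Divisibility using () renaming (_∣_ to _∣ℤ_)
open import Data.Fin using (Fin; toℕ)
open import Data.Product using (Σ; ∃; _×_; _,_; proj₁; proj₂)
open import Data.Sum using (_⊎_)
open import Data.List.Relation.Unary.All using (All)
open import Data.List.Relation.Unary.Unique.Propositional using (Unique)
open import Data.List using (List; []; _∷_; map; zipWith; foldr)
open import Data.Nat.ListAction using (product)
open import Relation.Binary.PropositionalEquality using (_≡_; _≢_)
open import Relation.Nullary using (¬_)

-- Elements of ℤ_n are represented by Fin n (residues 0,…,n-1).
-- A triple (x₁,x₂,x₃) satisfies x₁ + x₂ ≡ k·x₃ (mod n).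
IsTriple : (n : ℕ) (k : ℤ) → Fin n → Fin n → Fin n → Set
IsTriple n k x₁ x₂ x₃ =
  (+ n) ∣ℤ ((+ toℕ x₁) ℤ.+ (+ toℕ x₂) ℤ.- k ℤ.* (+ toℕ x₃))

-- An r-coloring: a surjective map ℤ_n → {1,…,r} (colours as Fin r).
Surjective : {n r : ℕ} → (Fin n → Fin r) → Set
Surjective {n} {r} c = ∀ (y : Fin r) → ∃ λ (x : Fin n) → c x ≡ y

Rainbow : {n r : ℕ} → (Fin n → Fin r) → Fin n → Fin n → Fin n → Set
Rainbow c x₁ x₂ x₃ = (c x₁ ≢ c x₂) × (c x₁ ≢ c x₃) × (c x₂ ≢ c x₃)

EveryColoringRainbow : (n : ℕ) (k : ℤ) (r : ℕ) → Set
EveryColoringRainbow n k r =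
  ∀ (c : Fin n → Fin r) → Surjective c →
  ∃ λ x₁ → ∃ λ x₂ → ∃ λ x₃ → IsTriple n k x₁ x₂ x₃ × Rainbow c x₁ x₂ x₃

-- rb(ℤ_n,k) = r : r is the smallest positive integer such that every
-- r-coloring of ℤ_n admits a rainbow triple, or r = n+1 if no such
-- r ≤ n exists.  (Note: for r > n there are no surjective colorings.)
IsRb : (n : ℕ) (k : ℤ) (r : ℕ) → Set
IsRb n k r =
  (1 ≤ r × EveryColoringRainbow n k r × (∀ s → 1 ≤ s → s < r → ¬ EveryColoringRainbow n k s))
  ⊎ (r ≡ suc n × (∀ s → 1 ≤ s → s ≤ n → ¬ EveryColoringRainbow n k s))

-- A prime factorization n = p₁^α₁ ⋯ p_m^α_m given as the list of pairs
-- (pᵢ , αᵢ) with distinct primes pᵢ and exponents αᵢ ≥ 1.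
IsPrimeFactorization : ℕ → List (ℕ × ℕ) → Set
IsPrimeFactorization n fs =
  All (λ pa → Prime (proj₁ pa) × 1 ≤ proj₂ pa) fs
  × Unique (map proj₁ fs)
  × n ≡ product (map (λ pa → proj₁ pa ^ proj₂ pa) fs)

-- 2 + Σᵢ αᵢ (ρᵢ − 2), computed in ℤ, where ρᵢ are given values
-- (paired with the factors (pᵢ,αᵢ) in the same order).
rbFormula : List (ℕ × ℕ) → List ℕ → ℤ
rbFormula fs ρs =
  + 2 ℤ.+ sumℤ (zipWith (λ pa ρ → + proj₂ pa ℤ.* (+ ρ ℤ.- + 2)) fs ρs)
  where
  sumℤ : List ℤ → ℤ
  sumℤ = foldr ℤ._+_ (+ 0)

module Submission where

-- rb(ℤ_n, 1) is additive over factorisations:  rb(ℤ_{st}) − 2 = (rb(ℤ_s) − 2) + (rb(ℤ_t) − 2)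
-- for all s, t ≥ 1, from which the formula over a prime factorisation follows by
-- induction on the exponents and on the list of prime powers.
--
-- We work with rainbow-free colourings of ℤ_n presented as n-periodic colourings of ℤ
-- (no rainbow (x , y , x + y)), and with the statement "some such colouring uses at least
-- k colours" (Realises n k).  rb(ℤ_n, 1) is then the least k that is not realised
-- (Threshold n k).  The additivity rests on two constructions for ℤ_{st}:
--   * lower bound: a symmetric colouring of ℤ_s with a + 1 colours and a colouring of ℤ_t
--     with b colours glue to one of ℤ_{st} with a + b colours (multiples of s are coloured
--     through ℤ_t, the rest through ℤ_s); any colouring can first be symmetrised;
--   * upper bound: a colouring of ℤ_{st} with r colours splits into one of the subgroup sℤ
--     (≅ ℤ_t) with the a colours occurring there, and one of the quotient ℤ_s with the
--     b = r − a remaining colours plus one, since each coset of sℤ carries at most one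
--     colour not occurring on sℤ.
-- Threshold is identified with the rb of the statement (IsRb) by translating between
-- surjective colourings Fin n → Fin r and periodic colourings of ℤ.

open import Defs
open import Data.Nat as ℕ using (ℕ; zero; suc; NonZero; _≤_; _<_; z≤n; s≤s; _^_)
import Data.Nat.Properties as ℕₚ
import Data.Nat.Divisibility as ℕ∣
open import Data.Nat.Primality using (prime⇒nonZero)
open import Data.Nat.ListAction using (product)
open import Data.Integer as ℤ using (ℤ; +_; _+_; _*_; -_; _-_)
import Data.Integer.Properties as ℤₚ
import Data.Integer.DivMod as ℤ÷
open import Data.Integer.Divisibility.Signed
  using (_∣_; divides; _∣?_; ∣-trans; ∣m∣n⇒∣m-n; ∣m∣n⇒∣m+n; ∣m⇒∣-m; ∣⇒∣ᵤ; ∣ᵤ⇒∣)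
open import Data.Integer.Tactic.RingSolver using (solve-∀)
open import Data.Fin as Fin using (Fin; toℕ; fromℕ<; splitAt; punchIn)
import Data.Fin.Properties as Finₚ
open import Data.Product using (Σ; ∃; _×_; _,_; proj₁; proj₂)
open import Data.Sum using (_⊎_; inj₁; inj₂; [_,_]′)
open import Data.Empty using (⊥; ⊥-elim)
open import Data.List using (List; []; _∷_; map)
open import Data.List.Relation.Unary.All as All using (All; []; _∷_)
open import Data.List.Relation.Binary.Pointwise using (Pointwise; []; _∷_)
open import Function using (_∘_)
open import Function.Definitions using (Injective)
open import Relation.Nullary using (¬_; Dec; yes; no; ¬?)
open import Relation.Nullary.Decidable using (_×-dec_)
open import Relation.Binary.PropositionalEquality

Distinct₃ : ℕ → ℕ → ℕ → Set
Distinct₃ a b c = (a ≢ b) × (a ≢ c) × (b ≢ c)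

distinct₃-subst : ∀ {a b c a′ b′ c′} → a ≡ a′ → b ≡ b′ → c ≡ c′ →
                  Distinct₃ a b c → Distinct₃ a′ b′ c′
distinct₃-subst refl refl refl d = d

swap₁₂ : ∀ {a b c} → Distinct₃ a b c → Distinct₃ b a c
swap₁₂ (a≢b , a≢c , b≢c) = ≢-sym a≢b , b≢c , a≢c

swap₂₃ : ∀ {a b c} → Distinct₃ a b c → Distinct₃ a c b
swap₂₃ (a≢b , a≢c , b≢c) = a≢c , a≢b , ≢-sym b≢c

swap₁₃ : ∀ {a b c} → Distinct₃ a b c → Distinct₃ c b a
swap₁₃ (a≢b , a≢c , b≢c) = ≢-sym b≢c , ≢-sym a≢c , ≢-sym a≢b

distinct₃-reflect : ∀ (f : ℕ → ℕ) {a b c} → Distinct₃ (f a) (f b) (f c) → Distinct₃ a b c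
distinct₃-reflect f (d₁ , d₂ , d₃) =
  (λ e → d₁ (cong f e)) , (λ e → d₂ (cong f e)) , (λ e → d₃ (cong f e))

third-repeats : ∀ {a b c} → ¬ Distinct₃ a b c → a ≢ b → c ≡ a ⊎ c ≡ b
third-repeats {a} {b} {c} not-rainbow a≢b with c ℕ.≟ a | c ℕ.≟ b
... | yes c≡a | _       = inj₁ c≡a
... | no _    | yes c≡b = inj₂ c≡b
... | no c≢a  | no c≢b  = ⊥-elim (not-rainbow (a≢b , ≢-sym c≢a , ≢-sym c≢b))

-- Congruence of integers modulo n, and the closure properties the constructions need.
-- (A record rather than a plain abbreviation, so that x and y can be inferred.)
infix 4 _≡_[mod_]
record _≡_[mod_] (x y : ℤ) (n : ℕ) : Set where
  constructor mod
  field
    divides-difference : + n ∣ (x - y)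

mod-refl : ∀ {n} x → x ≡ x [mod n ]
mod-refl x = mod (divides (+ 0) (ℤₚ.+-inverseʳ x))

mod-sym : ∀ {n x y} → x ≡ y [mod n ] → y ≡ x [mod n ]
mod-sym {n} {x} {y} (mod n∣x-y) = mod (subst (+ n ∣_) (negate x y) (∣m⇒∣-m n∣x-y))
  where
  negate : ∀ x y → - (x - y) ≡ y - x
  negate = solve-∀

mod-trans : ∀ {n x y z} → x ≡ y [mod n ] → y ≡ z [mod n ] → x ≡ z [mod n ]
mod-trans {n} {x} {y} {z} (mod n∣x-y) (mod n∣y-z) =
  mod (subst (+ n ∣_) (telescope x y z) (∣m∣n⇒∣m+n n∣x-y n∣y-z))
  where
  telescope : ∀ x y z → (x - y) + (y - z) ≡ x - z
  telescope = solve-∀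

mod-+ : ∀ {n x x′ y y′} → x ≡ x′ [mod n ] → y ≡ y′ [mod n ] → x + y ≡ x′ + y′ [mod n ]
mod-+ {n} {x} {x′} {y} {y′} (mod n∣x-x′) (mod n∣y-y′) =
  mod (subst (+ n ∣_) (regroup x x′ y y′) (∣m∣n⇒∣m+n n∣x-x′ n∣y-y′))
  where
  regroup : ∀ x x′ y y′ → (x - x′) + (y - y′) ≡ (x + y) - (x′ + y′)
  regroup = solve-∀

mod-neg : ∀ {n x y} → x ≡ y [mod n ] → - x ≡ - y [mod n ]
mod-neg {n} {x} {y} (mod n∣x-y) = mod (subst (+ n ∣_) (negate x y) (∣m⇒∣-m n∣x-y))
  where
  negate : ∀ x y → - (x - y) ≡ - x - - y
  negate = solve-∀

mod-weaken : ∀ {s t x y} → x ≡ y [mod s ℕ.* t ] → x ≡ y [mod s ]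
mod-weaken {s} {t} (mod st∣x-y) = mod (∣-trans (∣ᵤ⇒∣ (ℕ∣.m∣m*n t)) st∣x-y)

mod-scale : ∀ {s t x y} → x ≡ y [mod t ] → x * + s ≡ y * + s [mod s ℕ.* t ]
mod-scale {s} {t} {x} {y} (mod (divides m x-y≡mt)) = mod (divides m (begin
  x * + s - y * + s    ≡⟨ factor x y (+ s) ⟩
  (x - y) * + s        ≡⟨ cong (_* + s) x-y≡mt ⟩
  m * + t * + s        ≡⟨ regroup m (+ s) (+ t) ⟩
  m * (+ s * + t)      ≡⟨ cong (m *_) (ℤₚ.pos-* s t) ⟨
  m * + (s ℕ.* t)      ∎))
  where
  open ≡-Reasoning
  factor : ∀ x y S → x * S - y * S ≡ (x - y) * S
  factor = solve-∀
  regroup : ∀ m S T → m * T * S ≡ m * (S * T)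
  regroup = solve-∀

mod-unscale : ∀ {s t x y} {{_ : NonZero s}} → x * + s ≡ y * + s [mod s ℕ.* t ] → x ≡ y [mod t ]
mod-unscale {s} {t} {x} {y} (mod (divides m e)) =
  mod (divides m (ℤₚ.*-cancelʳ-≡ (x - y) (m * + t) (+ s) (begin
    (x - y) * + s        ≡⟨ factor x y (+ s) ⟨
    x * + s - y * + s    ≡⟨ e ⟩
    m * + (s ℕ.* t)      ≡⟨ cong (m *_) (ℤₚ.pos-* s t) ⟩
    m * (+ s * + t)      ≡⟨ regroup m (+ s) (+ t) ⟩
    m * + t * + s        ∎)))
  where
  open ≡-Reasoning
  factor : ∀ x y S → x * S - y * S ≡ (x - y) * S
  factor = solve-∀
  regroup : ∀ m S T → m * (S * T) ≡ m * T * S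
  regroup = solve-∀

+multiple : ∀ {n d} x → + n ∣ d → x ≡ x + d [mod n ]
+multiple {n} {d} x n∣d = mod (subst (+ n ∣_) (negate x d) (∣m⇒∣-m n∣d))
  where
  negate : ∀ x d → - d ≡ x - (x + d)
  negate = solve-∀

∣-resp-mod : ∀ {n x y} → + n ∣ x → x ≡ y [mod n ] → + n ∣ y
∣-resp-mod {n} {x} {y} n∣x (mod n∣x-y) = subst (+ n ∣_) (undo x y) (∣m∣n⇒∣m-n n∣x n∣x-y)
  where
  undo : ∀ x y → x - (x - y) ≡ y
  undo = solve-∀

residue : ∀ n {{_ : NonZero n}} → ℤ → Fin n
residue n z = fromℕ< (ℤ÷.n%ℕd<d z n)

residue-congruent : ∀ n {{_ : NonZero n}} z → z ≡ + toℕ (residue n z) [mod n ]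
residue-congruent n z = mod (divides (z ℤ÷./ℕ n) (begin
  z - r                     ≡⟨ cong (_- r) (ℤ÷.a≡a%ℕn+[a/ℕn]*n z n) ⟩
  + (z ℤ.%ℕ n) + q * + n - r ≡⟨ cong (λ k → + k + q * + n - r) (Finₚ.toℕ-fromℕ< (ℤ÷.n%ℕd<d z n)) ⟨
  r + q * + n - r           ≡⟨ cancel r q (+ n) ⟩
  q * + n                   ∎))
  where
  open ≡-Reasoning
  r q : ℤ
  r = + toℕ (residue n z)
  q = z ℤ÷./ℕ n
  cancel : ∀ r q N → r + q * N - r ≡ q * N
  cancel = solve-∀

-- Two elements of Fin n that are congruent modulo n are equal, since their difference is < n.
congruent-residues : ∀ n (i j : Fin n) → + toℕ i ≡ + toℕ j [mod n ] → i ≡ j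
congruent-residues n i j (mod n∣i-j) with ℤ.∣ + toℕ i - + toℕ j ∣ in gap
... | zero  = Finₚ.toℕ-injective (ℤₚ.+-injective (ℤₚ.i-j≡0⇒i≡j _ _ (ℤₚ.∣i∣≡0⇒i≡0 gap)))
... | suc _ = ⊥-elim (ℕ∣.>⇒∤ (subst (_< n) gap gap<n) (subst (n ℕ∣.∣_) gap (∣⇒∣ᵤ n∣i-j)))
  where
  gap<n : ℤ.∣ + toℕ i - + toℕ j ∣ < n
  gap<n = ℕₚ.≤-<-trans
    (subst (λ w → ℤ.∣ w ∣ ≤ toℕ i ℕ.⊔ toℕ j) (sym (ℤₚ.[+m]-[+n]≡m⊖n (toℕ i) (toℕ j)))
           (ℤₚ.∣m⊝n∣≤m⊔n (toℕ i) (toℕ j)))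
    (ℕₚ.⊔-pres-<m (Finₚ.toℕ<n i) (Finₚ.toℕ<n j))

residue-cong : ∀ n {{_ : NonZero n}} {x y} → x ≡ y [mod n ] → residue n x ≡ residue n y
residue-cong n {x} {y} x≡y = congruent-residues n _ _
  (mod-trans (mod-sym (residue-congruent n x)) (mod-trans x≡y (residue-congruent n y)))

residue-toℕ : ∀ n {{_ : NonZero n}} (i : Fin n) → residue n (+ toℕ i) ≡ i
residue-toℕ n i = congruent-residues n _ _ (mod-sym (residue-congruent n (+ toℕ i)))

same-residue : ∀ n {{_ : NonZero n}} {x y} → residue n x ≡ residue n y → x ≡ y [mod n ]
same-residue n {x} {y} e = mod-trans (residue-congruent n x)
  (subst (λ i → + toℕ i ≡ y [mod n ]) (sym e) (mod-sym (residue-congruent n y)))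

-- A rainbow-free colouring of ℤ_n, presented as an n-periodic colouring of ℤ by natural
-- numbers without rainbow triples (x , y , x + y).
record Colouring (n : ℕ) : Set where
  constructor mkColouring
  field
    colour      : ℤ → ℕ
    periodic    : ∀ x y → x ≡ y [mod n ] → colour x ≡ colour y
    rainbowFree : ∀ x y → ¬ Distinct₃ (colour x) (colour y) (colour (x + y))

Separated : ∀ {k} → (ℤ → ℕ) → (Fin k → ℤ) → Set
Separated χ rep = Injective _≡_ _≡_ (χ ∘ rep)

Realises : ℕ → ℕ → Set
Realises n k = Σ (Colouring n) λ C → Σ (Fin k → ℤ) λ rep → Separated (Colouring.colour C) rep

constant : ∀ n → Colouring n
constant n = mkColouring (λ _ → 0) (λ _ _ _ → refl) (λ _ _ rainbow → proj₁ rainbow refl)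

realises-0 : ∀ n → Realises n 0
realises-0 n = constant n , (λ ()) , λ {}

realises-1 : ∀ n → Realises n 1
realises-1 n = constant n , (λ _ → + 0) , λ { {Fin.zero} {Fin.zero} _ → refl }

realises-mono : ∀ {n k k′} → k ≤ k′ → Realises n k′ → Realises n k
realises-mono k≤k′ (C , rep , sep) =
  C , rep ∘ (λ i → Fin.inject≤ i k≤k′) , Finₚ.inject≤-injective k≤k′ k≤k′ _ _ ∘ sep

-- At most n colours: by pigeonhole two representatives would share a residue, hence a colour.
realises-≤ : ∀ n {{_ : NonZero n}} {k} → Realises n k → k ≤ n
realises-≤ n {k} (C , rep , sep) with k ℕ.≤? n
... | yes k≤n = k≤n
... | no k≰n with Finₚ.pigeonhole (ℕₚ.≰⇒> k≰n) (residue n ∘ rep)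
...   | (i , j , i<j , same) =
  ⊥-elim (Finₚ.<⇒≢ i<j (sep (Colouring.periodic C (rep i) (rep j) (same-residue n same))))

-- Symmetrisation: with A the colour of 0, recolour every point of colour A by the colour of
-- its negative.
-- The lower-bound construction needs a symmetric colouring of the quotient ℤ_s.
recolour : ℕ → ℕ → ℕ → ℕ
recolour A a b with a ℕ.≟ A
... | yes _ = b
... | no _  = a

recolour-hit : ∀ {A a} b → a ≡ A → recolour A a b ≡ b
recolour-hit {A} {a} b a≡A with a ℕ.≟ A
... | yes _  = refl
... | no a≢A = ⊥-elim (a≢A a≡A)

recolour-miss : ∀ {A a} b → a ≢ A → recolour A a b ≡ a
recolour-miss {A} {a} b a≢A with a ℕ.≟ A
... | yes a≡A = ⊥-elim (a≢A a≡A)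
... | no _    = refl

-x+[x+y]≡y : ∀ x y → - x + (x + y) ≡ y
-x+[x+y]≡y = solve-∀

-y+[x+y]≡x : ∀ x y → - y + (x + y) ≡ x
-y+[x+y]≡x = solve-∀

-[x+y]+x≡-y : ∀ x y → - (x + y) + x ≡ - y
-[x+y]+x≡-y = solve-∀

-[x+y]+y≡-x : ∀ x y → - (x + y) + y ≡ - x
-[x+y]+y≡-x = solve-∀

-x+-y≡-[x+y] : ∀ x y → - x + - y ≡ - (x + y)
-x+-y≡-[x+y] = solve-∀

module Symmetrise {n : ℕ} (C : Colouring n) where
  open Colouring C renaming (colour to χ)

  A : ℕ
  A = χ (+ 0)

  χ′ : ℤ → ℕ
  χ′ x = recolour A (χ x) (χ (- x))

  no-rainbow-at : ∀ x y {a b c} → Distinct₃ a b c → a ≡ χ x → b ≡ χ y → c ≡ χ (x + y) → ⊥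
  no-rainbow-at x y rainbow e₁ e₂ e₃ = rainbowFree x y (distinct₃-subst e₁ e₂ e₃ rainbow)

  -- If neither w nor -w has colour A they share a colour, for (w , -w , 0) is no rainbow.
  mirror : ∀ w → χ w ≢ A → χ (- w) ≢ A → χ w ≡ χ (- w)
  mirror w w≢A -w≢A with χ w ℕ.≟ χ (- w)
  ... | yes same = same
  ... | no differ =
    ⊥-elim (no-rainbow-at w (- w) (differ , w≢A , -w≢A) refl refl (cong χ (sym (ℤₚ.+-inverseʳ w))))

  data Recoloured (w : ℤ) : Set where
    kept    : χ w ≢ A → χ′ w ≡ χ w → Recoloured w
    flipped : χ w ≡ A → χ′ w ≡ χ (- w) → Recoloured w

  recoloured : ∀ w → Recoloured w
  recoloured w with χ w ℕ.≟ A
  ... | yes w≡A = flipped w≡A (recolour-hit (χ (- w)) w≡A)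
  ... | no w≢A  = kept w≢A (recolour-miss (χ (- w)) w≢A)

  -- Each rainbow of χ′ is, after negating some coordinates, a rainbow of χ.
  rainbowFree′ : ∀ x y → ¬ Distinct₃ (χ′ x) (χ′ y) (χ′ (x + y))
  rainbowFree′ x y R with recoloured x | recoloured y | recoloured (x + y)
  ... | kept _ ux | kept _ uy | kept _ uz = no-rainbow-at x y R ux uy uz
  ... | flipped _ fx | kept _ uy | kept _ uz =
    no-rainbow-at (- x) (x + y) (swap₂₃ R) fx uz (trans uy (cong χ (sym (-x+[x+y]≡y x y))))
  ... | kept _ ux | flipped _ fy | kept _ uz =
    no-rainbow-at (- y) (x + y) (swap₂₃ (swap₁₂ R)) fy uz (trans ux (cong χ (sym (-y+[x+y]≡x x y))))
  ... | flipped _ fx | flipped _ fy | flipped _ fz =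
    no-rainbow-at (- x) (- y) R fx fy (trans fz (cong χ (sym (-x+-y≡-[x+y] x y))))
  ... | flipped _ fx | kept _ uy | flipped _ fz =
    no-rainbow-at (- (x + y)) y (swap₁₃ R) fz uy (trans fx (cong χ (sym (-[x+y]+y≡-x x y))))
  ... | kept _ ux | flipped _ fy | flipped _ fz =
    no-rainbow-at (- (x + y)) x (swap₁₃ (swap₁₂ R)) fz ux (trans fy (cong χ (sym (-[x+y]+x≡-y x y))))
  ... | kept x≢A ux | kept y≢A uy | flipped z≡A _ =
    -- χ (x + y) = A would have to repeat χ x or χ y, neither of which is A.
    [ (λ z≡x → x≢A (trans (sym z≡x) z≡A)) , (λ z≡y → y≢A (trans (sym z≡y) z≡A)) ]′
    (third-repeats (λ r → no-rainbow-at x y r refl refl refl) (λ e → proj₁ R (trans ux (trans e (sym uy)))))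
  rainbowFree′ x y R | flipped x≡A fx | flipped y≡A fy | kept z≢A uz with χ (- x) ℕ.≟ A
  -- Both summands had colour A and x + y did not: use the rainbow (-x , x + y , y) if
  -- χ (-x) ≠ A, and (-y , x + y , x) otherwise (then χ (-y) ≠ χ (-x) = A).
  ... | no -x≢A = no-rainbow-at (- x) (x + y)
          (proj₁ (proj₂ R) , (λ e → -x≢A (trans (sym fx) e)) , (λ e → z≢A (trans (sym uz) e)))
          fx uz (trans (sym y≡A) (cong χ (sym (-x+[x+y]≡y x y))))
  ... | yes -x≡A = no-rainbow-at (- y) (x + y)
          (proj₂ (proj₂ R) , (λ e → proj₁ R (trans (trans fx -x≡A) (sym e))) , (λ e → z≢A (trans (sym uz) e)))
          fy uz (trans (sym x≡A) (cong χ (sym (-y+[x+y]≡x x y))))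

  periodic′ : ∀ x y → x ≡ y [mod n ] → χ′ x ≡ χ′ y
  periodic′ x y x≡y = cong₂ (recolour A) (periodic x y x≡y) (periodic (- x) (- y) (mod-neg x≡y))

  -- If x was recoloured it took the colour of -x; if neither was, mirror applies.
  symmetric : ∀ x → χ′ x ≡ χ′ (- x)
  symmetric x with recoloured x | recoloured (- x)
  ... | flipped x≡A fx | flipped -x≡A f-x =
    trans fx (trans -x≡A (trans (sym x≡A) (trans (cong χ (sym (ℤₚ.neg-involutive x))) (sym f-x))))
  ... | flipped _ fx | kept _ u-x = trans fx (sym u-x)
  ... | kept _ ux | flipped _ f-x = trans ux (trans (cong χ (sym (ℤₚ.neg-involutive x))) (sym f-x))
  ... | kept x≢A ux | kept -x≢A u-x = trans ux (trans (mirror x x≢A -x≢A) (sym u-x))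

  colouring : Colouring n
  colouring = mkColouring χ′ periodic′ rainbowFree′

  -- Every colour of χ survives: a point keeps its colour unless it had colour A,
  -- and A is still the colour of 0.
  witness : ℤ → ℤ
  witness z with χ z ℕ.≟ A
  ... | yes _ = + 0
  ... | no _  = z

  witness-colour : ∀ z → χ′ (witness z) ≡ χ z
  witness-colour z with χ z ℕ.≟ A
  ... | yes z≡A = trans (recolour-hit {A} {χ (+ 0)} (χ (+ 0)) refl) (sym z≡A)
  ... | no z≢A  = recolour-miss _ z≢A

symmetrise : ∀ {n k} → Realises n k →
             Σ (Realises n k) λ (C , _) → ∀ x → Colouring.colour C x ≡ Colouring.colour C (- x)
symmetrise (C , rep , sep) =
  (colouring , witness ∘ rep , λ e → sep (trans (sym (witness-colour _)) (trans e (witness-colour _)))) ,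
  symmetric
  where open Symmetrise C

-- Among k + 1 separated representatives at most one is divisible by s (all multiples of s
-- share the colour of 0), so some k of them avoid the multiples of s.
avoid-multiples : ∀ {s k} (C : Colouring s) (rep : Fin (suc k) → ℤ) →
  Separated (Colouring.colour C) rep →
  Σ (Fin k → ℤ) λ rep′ → Separated (Colouring.colour C) rep′ × (∀ i → ¬ (+ s ∣ rep′ i))
avoid-multiples {s} C rep sep with Finₚ.any? (λ j → + s ∣? rep j)
... | yes (j , s∣rep-j) =
  rep ∘ punchIn j , Finₚ.punchIn-injective j _ _ ∘ sep ,
  λ i s∣rep-i → Finₚ.punchInᵢ≢i j i (sep (Colouring.periodic C _ _ (mod (∣m∣n⇒∣m-n s∣rep-i s∣rep-j))))
... | no none = rep ∘ Fin.suc , Finₚ.suc-injective ∘ sep , λ i s∣rep-i → none (Fin.suc i , s∣rep-i)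

-- Colours of the glued colouring: even ones come from ℤ_t, odd ones from ℤ_s.
even odd : ℕ → ℕ
even c = 2 ℕ.* c
odd c = suc (2 ℕ.* c)

module Glue (s t : ℕ) {{_ : NonZero s}} (Cs : Colouring s) (Ct : Colouring t)
            (symmetric : ∀ x → Colouring.colour Cs x ≡ Colouring.colour Cs (- x)) where
  open Colouring Cs renaming (colour to χs; periodic to periodicₛ; rainbowFree to rainbowFreeₛ)
  open Colouring Ct renaming (colour to χt; periodic to periodicₜ; rainbowFree to rainbowFreeₜ)

  S : ℤ
  S = + s

  χ : ℤ → ℕ
  χ z with S ∣? z
  ... | yes (divides q _) = even (χt q)
  ... | no _              = odd (χs z)

  χ-multiple : ∀ {z} q → z ≡ q * S → χ z ≡ even (χt q)
  χ-multiple {z} q z≡qS with S ∣? z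
  ... | yes (divides q′ z≡q′S) = cong (even ∘ χt) (ℤₚ.*-cancelʳ-≡ q′ q S (trans (sym z≡q′S) z≡qS))
  ... | no s∤z                 = ⊥-elim (s∤z (divides q z≡qS))

  χ-other : ∀ {z} → ¬ (S ∣ z) → χ z ≡ odd (χs z)
  χ-other {z} s∤z with S ∣? z
  ... | yes s∣z = ⊥-elim (s∤z s∣z)
  ... | no _    = refl

  periodic : ∀ x y → x ≡ y [mod s ℕ.* t ] → χ x ≡ χ y
  periodic x y x≡y with S ∣? x | S ∣? y
  ... | yes (divides qx x≡qxS) | yes (divides qy y≡qyS) =
    cong even (periodicₜ qx qy
      (mod-unscale {s} {t} (subst₂ (λ a b → a ≡ b [mod s ℕ.* t ]) x≡qxS y≡qyS x≡y)))
  ... | yes s∣x | no s∤y = ⊥-elim (s∤y (∣-resp-mod s∣x (mod-weaken {s} {t} x≡y)))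
  ... | no s∤x  | yes s∣y = ⊥-elim (s∤x (∣-resp-mod s∣y (mod-sym (mod-weaken {s} {t} x≡y))))
  ... | no _    | no _    = cong odd (periodicₛ x y (mod-weaken {s} {t} x≡y))

  -- Four cases: both summands in sℤ (rainbow of ℤ_t); exactly one (the other summand and
  -- the sum agree modulo s); none but the sum (then y ≡ -x, and symmetry applies); none at all
  -- (rainbow of ℤ_s).
  rainbowFree : ∀ x y → ¬ Distinct₃ (χ x) (χ y) (χ (x + y))
  rainbowFree x y R = cases (S ∣? x) (S ∣? y) (S ∣? (x + y))
    where
    cases : Dec (S ∣ x) → Dec (S ∣ y) → Dec (S ∣ (x + y)) → ⊥
    cases (yes (divides qx x≡qxS)) (yes (divides qy y≡qyS)) _ =
      rainbowFreeₜ qx qy (distinct₃-reflect even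
        (distinct₃-subst (χ-multiple qx x≡qxS) (χ-multiple qy y≡qyS) (χ-multiple (qx + qy) x+y≡[qx+qy]S) R))
      where
      x+y≡[qx+qy]S : x + y ≡ (qx + qy) * S
      x+y≡[qx+qy]S = trans (cong₂ _+_ x≡qxS y≡qyS) (sym (ℤₚ.*-distribʳ-+ S qx qy))
    cases (yes s∣x) (no s∤y) _ =
      proj₂ (proj₂ R) (trans (χ-other s∤y) (trans (cong odd (periodicₛ y (x + y) y≡x+y)) (sym (χ-other s∤x+y))))
      where
      y≡x+y : y ≡ x + y [mod s ]
      y≡x+y = subst (λ w → y ≡ w [mod s ]) (ℤₚ.+-comm y x) (+multiple y s∣x)
      s∤x+y : ¬ (S ∣ (x + y))
      s∤x+y s∣x+y = s∤y (∣-resp-mod s∣x+y (mod-sym y≡x+y))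
    cases (no s∤x) (yes s∣y) _ =
      proj₁ (proj₂ R) (trans (χ-other s∤x) (trans (cong odd (periodicₛ x (x + y) x≡x+y)) (sym (χ-other s∤x+y))))
      where
      x≡x+y : x ≡ x + y [mod s ]
      x≡x+y = +multiple x s∣y
      s∤x+y : ¬ (S ∣ (x + y))
      s∤x+y s∣x+y = s∤x (∣-resp-mod s∣x+y (mod-sym x≡x+y))
    cases (no s∤x) (no s∤y) (yes s∣x+y) =
      proj₁ R (trans (χ-other s∤x) (trans (cong odd (trans (symmetric x) (periodicₛ (- x) y -x≡y))) (sym (χ-other s∤y))))
      where
      -x≡y : - x ≡ y [mod s ]
      -x≡y = subst (λ w → - x ≡ w [mod s ]) (-x+[x+y]≡y x y) (+multiple (- x) s∣x+y)
    cases (no s∤x) (no s∤y) (no s∤x+y) =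
      rainbowFreeₛ x y (distinct₃-reflect odd (distinct₃-subst (χ-other s∤x) (χ-other s∤y) (χ-other s∤x+y) R))

  colouring : Colouring (s ℕ.* t)
  colouring = mkColouring χ periodic rainbowFree

-- Symmetrise the colouring of ℤ_s, drop a representative divisible by s, and glue; the
-- remaining representatives of ℤ_s get odd colours, the scaled ones of ℤ_t even colours.
realises-product : ∀ s t {{_ : NonZero s}} {a b} →
  Realises s (suc a) → Realises t b → Realises (s ℕ.* t) (a ℕ.+ b)
realises-product s t {a} {b} realises-s (Ct , repₜ , sepₜ) with symmetrise realises-s
... | ((Cs , repₛ , sepₛ) , symmetric) with avoid-multiples Cs repₛ sepₛ
... | (rep′ , sep′ , s∤rep′) = colouring , rep ∘ splitAt a , separated
  where
  open Glue s t Cs Ct symmetric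
  χs χt : ℤ → ℕ
  χs = Colouring.colour Cs
  χt = Colouring.colour Ct

  rep : Fin a ⊎ Fin b → ℤ
  rep (inj₁ i) = rep′ i
  rep (inj₂ j) = repₜ j * S

  -- Odd colours are told apart in ℤ_s, even ones in ℤ_t, and odd ≠ even.
  rep-injective : Injective _≡_ _≡_ (χ ∘ rep)
  rep-injective {inj₁ i} {inj₁ i′} e = cong inj₁ (sep′ (ℕₚ.*-cancelˡ-≡ _ _ 2 (ℕₚ.suc-injective
    (trans (sym (χ-other (s∤rep′ i))) (trans e (χ-other (s∤rep′ i′)))))))
  rep-injective {inj₁ i} {inj₂ j} e = ⊥-elim (ℕₚ.even≢odd (χt (repₜ j)) (χs (rep′ i))
    (trans (sym (χ-multiple (repₜ j) refl)) (trans (sym e) (χ-other (s∤rep′ i)))))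
  rep-injective {inj₂ j} {inj₁ i} e = ⊥-elim (ℕₚ.even≢odd (χt (repₜ j)) (χs (rep′ i))
    (trans (sym (χ-multiple (repₜ j) refl)) (trans e (χ-other (s∤rep′ i)))))
  rep-injective {inj₂ j} {inj₂ j′} e = cong inj₂ (sepₜ (ℕₚ.*-cancelˡ-≡ _ _ 2
    (trans (sym (χ-multiple (repₜ j) refl)) (trans e (χ-multiple (repₜ j′) refl)))))

  separated : Injective _≡_ _≡_ (χ ∘ rep ∘ splitAt a)
  separated {i} {j} e = trans (sym (Finₚ.join-splitAt a b i))
    (trans (cong (Fin.join a b) (rep-injective {splitAt a i} {splitAt a j} e)) (Finₚ.join-splitAt a b j))

-- Fix a rainbow-free colouring χ of ℤ_{st}; the subgroup sℤ of
-- ℤ_{st} is represented by the points j · s with j : Fin t.  A colour is inner if it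
-- occurs on sℤ, and outer otherwise.
module Split (s t : ℕ) {{_ : NonZero s}} {{_ : NonZero t}} (C : Colouring (s ℕ.* t)) where
  open Colouring C renaming (colour to χ)

  S : ℤ
  S = + s

  Inner : ℕ → Set
  Inner c = ∃ λ (j : Fin t) → χ (+ toℕ j * S) ≡ c

  inner? : ∀ c → Dec (Inner c)
  inner? c = Finₚ.any? (λ j → χ (+ toℕ j * S) ℕ.≟ c)

  -- Every multiple of s has an inner colour (reduce h / s modulo t).
  inner-multiple : ∀ {h} → S ∣ h → Inner (χ h)
  inner-multiple {h} (divides q h≡qS) =
    residue t q ,
    periodic _ h (subst (λ w → + toℕ (residue t q) * S ≡ w [mod s ℕ.* t ]) (sym h≡qS)
                        (mod-scale {s} {t} (mod-sym (residue-congruent t q))))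

  -- In each coset of sℤ at most one outer colour occurs: for u ≡ v (mod s) of different
  -- outer colours, (u - v , v , u) would be a rainbow with u - v ∈ sℤ.
  outer-unique : ∀ u v → u ≡ v [mod s ] → ¬ Inner (χ u) → ¬ Inner (χ v) → χ u ≡ χ v
  outer-unique u v (mod s∣u-v) u-outer v-outer with χ u ℕ.≟ χ v
  ... | yes same  = same
  ... | no differ = ⊥-elim (rainbowFree (u - v) v
        ((λ e → v-outer (subst Inner e (inner-multiple s∣u-v))) ,
         (λ e → u-outer (subst Inner (trans e (cong χ (u-v+v≡u u v))) (inner-multiple s∣u-v))) ,
         (λ e → differ (trans (cong χ (sym (u-v+v≡u u v))) (sym e)))))
    where
    u-v+v≡u : ∀ u v → u - v + v ≡ u
    u-v+v≡u = solve-∀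

  HasOuter : ℤ → Set
  HasOuter z = ∃ λ (j : Fin t) → ¬ Inner (χ (z + + toℕ j * S))

  outer? : ∀ z → Dec (HasOuter z)
  outer? z = Finₚ.any? (λ j → ¬? (inner? (χ (z + + toℕ j * S))))

  χq : ℤ → ℕ
  χq z with outer? z
  ... | yes (j , _) = suc (χ (z + + toℕ j * S))
  ... | no _        = 0

  χq-outer : ∀ z w → w ≡ z [mod s ] → ¬ Inner (χ w) → χq z ≡ suc (χ w)
  χq-outer z w w≡z@(mod (divides q w-z≡qS)) w-outer with outer? z
  ... | yes (j , outer-j) =
    cong suc (outer-unique _ w (mod-trans (mod-sym (+multiple z (divides (+ toℕ j) refl))) (mod-sym w≡z))
                           outer-j w-outer)
  ... | no none = ⊥-elim (none (residue t q , λ inner → w-outer (subst Inner (periodic _ w z+rS≡w) inner)))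
    where
    -- w = z + q · s, and q may be replaced by its residue modulo t.
    z+rS≡w : z + + toℕ (residue t q) * S ≡ w [mod s ℕ.* t ]
    z+rS≡w = subst (λ v → z + + toℕ (residue t q) * S ≡ v [mod s ℕ.* t ]) w≡z+qS
      (mod-+ (mod-refl z) (mod-sym (mod-scale {s} {t} (residue-congruent t q))))
      where
      w≡z+qS : z + q * S ≡ w
      w≡z+qS = trans (cong (λ d → z + d) (sym w-z≡qS)) (z+[w-z]≡w z w)
        where
        z+[w-z]≡w : ∀ z w → z + (w - z) ≡ w
        z+[w-z]≡w = solve-∀

  χq-inner : ∀ z → ¬ HasOuter z → χq z ≡ 0
  χq-inner z no-outer with outer? z
  ... | yes has-outer = ⊥-elim (no-outer has-outer)
  ... | no _          = refl

  data CosetColour (z : ℤ) : Set where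
    inner-only : χq z ≡ 0 → CosetColour z
    outer      : ∀ w → w ≡ z [mod s ] → ¬ Inner (χ w) → χq z ≡ suc (χ w) → CosetColour z

  coset-colour : ∀ z → CosetColour z
  coset-colour z with outer? z
  ... | yes (j , outer-j) = outer _ z+jS≡z outer-j (χq-outer z _ z+jS≡z outer-j)
    where
    z+jS≡z : z + + toℕ j * S ≡ z [mod s ]
    z+jS≡z = mod-sym (+multiple z (divides (+ toℕ j) refl))
  ... | no no-outer = inner-only (χq-inner z no-outer)

  χq-0 : χq (+ 0) ≡ 0
  χq-0 with coset-colour (+ 0)
  ... | inner-only χq-0≡0 = χq-0≡0
  ... | outer w w≡0 w-outer _ = ⊥-elim (w-outer (inner-multiple (∣-resp-mod (divides (+ 0) refl) (mod-sym w≡0))))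

  periodicq : ∀ x y → x ≡ y [mod s ] → χq x ≡ χq y
  periodicq x y x≡y with coset-colour x | coset-colour y
  ... | outer w w≡x w-outer χq-x | _ = trans χq-x (sym (χq-outer y w (mod-trans w≡x x≡y) w-outer))
  ... | inner-only χq-x | outer w w≡y w-outer _ =
    ⊥-elim (ℕₚ.0≢1+n (trans (sym χq-x) (χq-outer x w (mod-trans w≡y (mod-sym x≡y)) w-outer)))
  ... | inner-only χq-x | inner-only χq-y = trans χq-x (sym χq-y)

  -- Two outer cosets: the colour of wx + wy repeats that of wx or of wy and is then outer,
  -- so the coset of x + y has the colour of the coset of x or of y.
  rainbowFree-outer : ∀ x y wx wy → wx ≡ x [mod s ] → wy ≡ y [mod s ] →
    ¬ Inner (χ wx) → ¬ Inner (χ wy) → χq x ≡ suc (χ wx) → χq y ≡ suc (χ wy) →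
    ¬ Distinct₃ (χq x) (χq y) (χq (x + y))
  rainbowFree-outer x y wx wy wx≡x wy≡y wx-outer wy-outer χq-x χq-y R =
    [ (λ e → proj₁ (proj₂ R) (trans χq-x (sym (sum-repeats e wx-outer)))) ,
      (λ e → proj₂ (proj₂ R) (trans χq-y (sym (sum-repeats e wy-outer)))) ]′
    (third-repeats (rainbowFree wx wy) (λ e → proj₁ R (trans χq-x (trans (cong suc e) (sym χq-y)))))
    where
    sum-repeats : ∀ {w} → χ (wx + wy) ≡ χ w → ¬ Inner (χ w) → χq (x + y) ≡ suc (χ w)
    sum-repeats e w-outer =
      trans (χq-outer (x + y) (wx + wy) (mod-+ wx≡x wy≡y) (λ inner → w-outer (subst Inner e inner))) (cong suc e)

  -- The coset of x inner-only, that of y outer: the point wz - wy of the coset of x has an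
  -- inner colour, and (wz - wy , wy , wz) would be a rainbow.
  rainbowFree-mixed : ∀ x y wy → wy ≡ y [mod s ] → ¬ Inner (χ wy) → χq x ≡ 0 → χq y ≡ suc (χ wy) →
    ¬ Distinct₃ (χq x) (χq y) (χq (x + y))
  rainbowFree-mixed x y wy wy≡y wy-outer χq-x χq-y R with coset-colour (x + y)
  ... | inner-only χq-z = proj₁ (proj₂ R) (trans χq-x (sym χq-z))
  ... | outer wz wz≡z wz-outer χq-z with inner? (χ (wz - wy))
  ...   | no d-outer = ℕₚ.0≢1+n (trans (sym χq-x) (χq-outer x (wz - wy) wz-wy≡x d-outer))
    where
    wz-wy≡x : wz - wy ≡ x [mod s ]
    wz-wy≡x = subst (λ v → wz - wy ≡ v [mod s ]) ([x+y]-y≡x x y) (mod-+ wz≡z (mod-neg wy≡y))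
      where
      [x+y]-y≡x : ∀ x y → x + y - y ≡ x
      [x+y]-y≡x = solve-∀
  ...   | yes d-inner = rainbowFree (wz - wy) wy
          ((λ e → wy-outer (subst Inner e d-inner)) ,
           (λ e → wz-outer (subst Inner (trans e (cong χ (wz-wy+wy≡wz wz wy))) d-inner)) ,
           (λ e → proj₂ (proj₂ R) (trans χq-y (trans (cong suc (trans e (cong χ (wz-wy+wy≡wz wz wy)))) (sym χq-z)))))
    where
    wz-wy+wy≡wz : ∀ u v → u - v + v ≡ u
    wz-wy+wy≡wz = solve-∀

  rainbowFreeq : ∀ x y → ¬ Distinct₃ (χq x) (χq y) (χq (x + y))
  rainbowFreeq x y R with coset-colour x | coset-colour y
  ... | inner-only χq-x | inner-only χq-y = proj₁ R (trans χq-x (sym χq-y))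
  ... | outer wx wx≡x wx-outer χq-x | outer wy wy≡y wy-outer χq-y =
    rainbowFree-outer x y wx wy wx≡x wy≡y wx-outer wy-outer χq-x χq-y R
  ... | inner-only χq-x | outer wy wy≡y wy-outer χq-y = rainbowFree-mixed x y wy wy≡y wy-outer χq-x χq-y R
  ... | outer wx wx≡x wx-outer χq-x | inner-only χq-y =
    rainbowFree-mixed y x wx wx≡x wx-outer χq-y χq-x (distinct₃-subst refl refl (cong χq (ℤₚ.+-comm x y)) (swap₁₂ R))

  quotient : Colouring s
  quotient = mkColouring χq periodicq rainbowFreeq

  restriction : Colouring t
  restriction = mkColouring (λ z → χ (z * S)) (λ x y x≡y → periodic _ _ (mod-scale {s} {t} x≡y))
    (λ x y R → rainbowFree (x * S) (y * S) (distinct₃-subst refl refl (cong χ (ℤₚ.*-distribʳ-+ S x y)) R))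

record Partition {r : ℕ} (P : Fin r → Set) : Set where
  field
    #in #out          : ℕ
    sizes             : #in ℕ.+ #out ≡ r
    inside            : Fin #in → Fin r
    outside           : Fin #out → Fin r
    inside-injective  : Injective _≡_ _≡_ inside
    outside-injective : Injective _≡_ _≡_ outside
    inside-P          : ∀ i → P (inside i)
    outside-¬P        : ∀ i → ¬ P (outside i)

partition : ∀ {r} (P : Fin r → Set) → (∀ i → Dec (P i)) → Partition P
partition {zero} P P? = record
  { #in = 0 ; #out = 0 ; sizes = refl ; inside = λ () ; outside = λ ()
  ; inside-injective = λ {} ; outside-injective = λ {} ; inside-P = λ () ; outside-¬P = λ () }
partition {suc r} P P? with partition (P ∘ Fin.suc) (P? ∘ Fin.suc) | P? Fin.zero
... | rest | yes P0 = record
  { #in = suc #in ; #out = #out ; sizes = cong suc sizes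
  ; inside = Fin.lift 1 inside ; outside = Fin.suc ∘ outside
  ; inside-injective = Finₚ.lift-injective inside inside-injective 1
  ; outside-injective = outside-injective ∘ Finₚ.suc-injective
  ; inside-P = λ { Fin.zero → P0 ; (Fin.suc i) → inside-P i } ; outside-¬P = outside-¬P }
  where open Partition rest
... | rest | no ¬P0 = record
  { #in = #in ; #out = suc #out ; sizes = trans (ℕₚ.+-suc #in #out) (cong suc sizes)
  ; inside = Fin.suc ∘ inside ; outside = Fin.lift 1 outside
  ; inside-injective = inside-injective ∘ Finₚ.suc-injective
  ; outside-injective = Finₚ.lift-injective outside outside-injective 1
  ; inside-P = inside-P ; outside-¬P = λ { Fin.zero → ¬P0 ; (Fin.suc i) → outside-¬P i } }
  where open Partition rest

-- Upper bound: r colours on ℤ_{st} split as a + b, with a colours on ℤ_t (the inner ones,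
-- via the restriction) and b + 1 on ℤ_s (the outer ones and 0, via the quotient).
realises-split : ∀ s t {{_ : NonZero s}} {{_ : NonZero t}} {r} → Realises (s ℕ.* t) r →
  Σ ℕ λ a → Σ ℕ λ b → (a ℕ.+ b ≡ r) × Realises t a × Realises s (suc b)
realises-split s t (C , rep , sep) =
  #in , #out , sizes , (restriction , inner-rep , inner-separated) , (quotient , outer-rep , outer-separated)
  where
  open Split s t C
  χ : ℤ → ℕ
  χ = Colouring.colour C
  open Partition (partition (λ i → Inner (χ (rep i))) (λ i → inner? (χ (rep i))))

  inner-rep : Fin #in → ℤ
  inner-rep i = + toℕ (proj₁ (inside-P i))

  inner-separated : Separated (Colouring.colour restriction) inner-rep
  inner-separated e = inside-injective (sep (trans (sym (proj₂ (inside-P _))) (trans e (proj₂ (inside-P _)))))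

  outer-rep : Fin (suc #out) → ℤ
  outer-rep Fin.zero    = + 0
  outer-rep (Fin.suc i) = rep (outside i)

  outer-colour : ∀ i → χq (rep (outside i)) ≡ suc (χ (rep (outside i)))
  outer-colour i = χq-outer _ _ (mod-refl _) (outside-¬P i)

  outer-separated : Separated χq outer-rep
  outer-separated {Fin.zero}  {Fin.zero}  _ = refl
  outer-separated {Fin.zero}  {Fin.suc j} e = ⊥-elim (ℕₚ.0≢1+n (trans (sym χq-0) (trans e (outer-colour j))))
  outer-separated {Fin.suc i} {Fin.zero}  e = ⊥-elim (ℕₚ.0≢1+n (trans (sym χq-0) (trans (sym e) (outer-colour i))))
  outer-separated {Fin.suc i} {Fin.suc j} e = cong Fin.suc (outside-injective (sep
    (ℕₚ.suc-injective (trans (sym (outer-colour i)) (trans e (outer-colour j))))))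

-- R is the least number of colours that no rainbow-free colouring of ℤ_n attains: every
-- smaller k is attained (in the double-negated sense) and R is not.
Threshold : ℕ → ℕ → Set
Threshold n R = (∀ k → k < R → ¬ ¬ Realises n k) × ¬ Realises n R

threshold-≥2 : ∀ {n R} → Threshold n R → 2 ≤ R
threshold-≥2 {n} {zero}          (_ , not-0) = ⊥-elim (not-0 (realises-0 n))
threshold-≥2 {n} {suc zero}      (_ , not-1) = ⊥-elim (not-1 (realises-1 n))
threshold-≥2 {n} {suc (suc R)} _ = s≤s (s≤s z≤n)

threshold-1 : Threshold 1 2
threshold-1 = attained , λ realised → ℕₚ.n≮n 1 (realises-≤ 1 realised)
  where
  attained : ∀ k → k < 2 → ¬ ¬ Realises 1 k
  attained zero          _ not-0 = not-0 (realises-0 1)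
  attained (suc zero)    _ not-1 = not-1 (realises-1 1)
  attained (suc (suc k)) (s≤s (s≤s ()))

threshold-product : ∀ s t {{_ : NonZero s}} {{_ : NonZero t}} a b →
  Threshold s (2 ℕ.+ a) → Threshold t (2 ℕ.+ b) → Threshold (s ℕ.* t) (2 ℕ.+ (a ℕ.+ b))
threshold-product s t a b (attained-s , bound-s) (attained-t , bound-t) = attained , bound
  where
  attained : ∀ k → k < 2 ℕ.+ (a ℕ.+ b) → ¬ ¬ Realises (s ℕ.* t) k
  attained k k<R not-k =
    attained-s (suc a) (ℕₚ.n<1+n (suc a)) λ realises-s →
    attained-t (suc b) (ℕₚ.n<1+n (suc b)) λ realises-t →
    not-k (realises-mono (subst (k ≤_) (sym (ℕₚ.+-suc a b)) (ℕₚ.≤-pred k<R))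
                         (realises-product s t realises-s realises-t))

  bound : ¬ Realises (s ℕ.* t) (2 ℕ.+ (a ℕ.+ b))
  bound realised with realises-split s t realised
  ... | (a′ , b′ , a′+b′≡R , realises-t , realises-s) with a′ ℕ.≤? suc b | b′ ℕ.≤? a
  ...   | no a′≰1+b | _       = bound-t (realises-mono (ℕₚ.≰⇒> a′≰1+b) realises-t)
  ...   | yes _     | no b′≰a = bound-s (realises-mono (s≤s (ℕₚ.≰⇒> b′≰a)) realises-s)
  ...   | yes a′≤1+b | yes b′≤a = ℕₚ.n≮n (a ℕ.+ b) (subst (suc (a ℕ.+ b) ≤_) (ℕₚ.+-comm b a)
          (ℕₚ.≤-pred (subst (_≤ suc b ℕ.+ a) a′+b′≡R (ℕₚ.+-mono-≤ a′≤1+b b′≤a))))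

threshold-product′ : ∀ s t {{_ : NonZero s}} {{_ : NonZero t}} {A B} → Threshold s A → Threshold t B →
  Σ ℕ λ R → Threshold (s ℕ.* t) R × (+ R ≡ + A + + B - + 2)
threshold-product′ s t {A} {B} TA TB with threshold-≥2 TA | threshold-≥2 TB
threshold-product′ s t {suc (suc a)} {suc (suc b)} TA TB | s≤s (s≤s _) | s≤s (s≤s _) =
  2 ℕ.+ (a ℕ.+ b) , threshold-product s t a b TA TB ,
  trans (cong (λ c → + 2 + c) (ℤₚ.pos-+ a b)) (regroup (+ a) (+ b))
  where
  regroup : ∀ a b → + 2 + (a + b) ≡ (+ 2 + a) + (+ 2 + b) - + 2
  regroup = solve-∀

RainbowFree : ∀ {n r} → (Fin n → Fin r) → Set
RainbowFree {n} c = ∀ x₁ x₂ x₃ → IsTriple n (+ 1) x₁ x₂ x₃ → ¬ Rainbow c x₁ x₂ x₃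

realises-from-finite : ∀ n {{_ : NonZero n}} {r} (c : Fin n → Fin r) →
  Surjective c → RainbowFree c → Realises n r
realises-from-finite n {r} c surjective rainbow-free = colouring , rep , separated
  where
  χ : ℤ → ℕ
  χ z = toℕ (c (residue n z))

  triple : ∀ x y → IsTriple n (+ 1) (residue n x) (residue n y) (residue n (x + y))
  triple x y = ∣⇒∣ᵤ (subst (λ w → + n ∣ (rx + ry - w)) (sym (ℤₚ.*-identityˡ rz))
                          (_≡_[mod_].divides-difference rx+ry≡rz))
    where
    rx ry rz : ℤ
    rx = + toℕ (residue n x)
    ry = + toℕ (residue n y)
    rz = + toℕ (residue n (x + y))
    rx+ry≡rz : rx + ry ≡ rz [mod n ]
    rx+ry≡rz = mod-trans (mod-+ (mod-sym (residue-congruent n x)) (mod-sym (residue-congruent n y)))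
                         (residue-congruent n (x + y))

  distinct : ∀ {a b : Fin r} → toℕ a ≢ toℕ b → a ≢ b
  distinct toℕ-a≢toℕ-b a≡b = toℕ-a≢toℕ-b (cong toℕ a≡b)

  colouring : Colouring n
  colouring = mkColouring χ (λ x y x≡y → cong (toℕ ∘ c) (residue-cong n x≡y))
    (λ x y (d₁ , d₂ , d₃) → rainbow-free _ _ _ (triple x y) (distinct d₁ , distinct d₂ , distinct d₃))

  rep : Fin r → ℤ
  rep i = + toℕ (proj₁ (surjective i))

  rep-colour : ∀ i → χ (rep i) ≡ toℕ i
  rep-colour i = cong toℕ (trans (cong c (residue-toℕ n _)) (proj₂ (surjective i)))

  separated : Separated χ rep
  separated e = Finₚ.toℕ-injective (trans (sym (rep-colour _)) (trans e (rep-colour _)))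

-- Conversely, a colouring realising r + 1 colours gives a surjective rainbow-free
-- ℤ_n → Fin (r + 1): send a point to the index of the representative of its colour.
finite-from-realises : ∀ n {{_ : NonZero n}} {r} → Realises n (suc r) →
  Σ (Fin n → Fin (suc r)) λ c → Surjective c × RainbowFree c
finite-from-realises n {r} (C , rep , sep) = c , surjective , rainbow-free
  where
  open Colouring C renaming (colour to χ)

  index : ℕ → Fin (suc r)
  index col with Finₚ.any? (λ i → χ (rep i) ℕ.≟ col)
  ... | yes (i , _) = i
  ... | no _        = Fin.zero

  index-rep : ∀ i → index (χ (rep i)) ≡ i
  index-rep i with Finₚ.any? (λ i′ → χ (rep i′) ℕ.≟ χ (rep i))
  ... | yes (_ , same) = sep same
  ... | no none        = ⊥-elim (none (i , refl))

  c : Fin n → Fin (suc r)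
  c x = index (χ (+ toℕ x))

  surjective : Surjective c
  surjective i = residue n (rep i) ,
    trans (cong index (periodic _ _ (mod-sym (residue-congruent n (rep i))))) (index-rep i)

  -- A triple x₁ + x₂ ≡ x₃ makes the colour of x₃ that of x₁ + x₂ in ℤ.
  rainbow-free : RainbowFree c
  rainbow-free x₁ x₂ x₃ triple (d₁ , d₂ , d₃) = rainbowFree (+ toℕ x₁) (+ toℕ x₂)
    ((λ e → d₁ (cong index e)) ,
     (λ e → d₂ (cong index (trans e sum-colour))) ,
     (λ e → d₃ (cong index (trans e sum-colour))))
    where
    sum-colour : χ (+ toℕ x₁ + + toℕ x₂) ≡ χ (+ toℕ x₃)
    sum-colour = periodic _ _ (mod (subst (λ w → + n ∣ (+ toℕ x₁ + + toℕ x₂ - w))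
                                          (ℤₚ.*-identityˡ (+ toℕ x₃)) (∣ᵤ⇒∣ triple)))

rainbow? : ∀ n {r} (c : Fin n → Fin r) →
  Dec (∃ λ x₁ → ∃ λ x₂ → ∃ λ x₃ → IsTriple n (+ 1) x₁ x₂ x₃ × Rainbow c x₁ x₂ x₃)
rainbow? n c = Finₚ.any? λ x₁ → Finₚ.any? λ x₂ → Finₚ.any? λ x₃ →
  (n ℕ∣.∣? ℤ.∣ + toℕ x₁ + + toℕ x₂ - + 1 * + toℕ x₃ ∣) ×-dec
  (¬? (c x₁ Finₚ.≟ c x₂) ×-dec ¬? (c x₁ Finₚ.≟ c x₃) ×-dec ¬? (c x₂ Finₚ.≟ c x₃))

every-rainbow : ∀ n {{_ : NonZero n}} r → ¬ Realises n r → EveryColoringRainbow n (+ 1) r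
every-rainbow n r not-realised c surjective with rainbow? n c
... | yes rainbow = rainbow
... | no none = ⊥-elim (not-realised (realises-from-finite n c surjective
        (λ x₁ x₂ x₃ triple rainbow → none (x₁ , x₂ , x₃ , triple , rainbow))))

not-every-rainbow : ∀ n {{_ : NonZero n}} r → 1 ≤ r → Realises n r → ¬ EveryColoringRainbow n (+ 1) r
not-every-rainbow n (suc r) _ realised every with finite-from-realises n realised
... | (c , surjective , rainbow-free) with every c surjective
...   | (x₁ , x₂ , x₃ , triple , rainbow) = rainbow-free x₁ x₂ x₃ triple rainbow

isRb⇒threshold : ∀ n {{_ : NonZero n}} R → IsRb n (+ 1) R → Threshold n R
isRb⇒threshold n R (inj₁ (1≤R , every , minimal)) =
  attained , λ realised → not-every-rainbow n R 1≤R realised every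
  where
  attained : ∀ k → k < R → ¬ ¬ Realises n k
  attained zero    _   not-0 = not-0 (realises-0 n)
  attained (suc k) k<R not-k = minimal (suc k) (s≤s z≤n) k<R (every-rainbow n (suc k) not-k)
isRb⇒threshold n .(suc n) (inj₂ (refl , none)) =
  attained , λ realised → ℕₚ.n≮n n (realises-≤ n realised)
  where
  attained : ∀ k → k < suc n → ¬ ¬ Realises n k
  attained zero    _   not-0 = not-0 (realises-0 n)
  attained (suc k) k<R not-k = none (suc k) (s≤s z≤n) (ℕₚ.≤-pred k<R) (every-rainbow n (suc k) not-k)

threshold⇒isRb : ∀ n {{_ : NonZero n}} R → Threshold n R → IsRb n (+ 1) R
threshold⇒isRb n R T@(attained , bound) with R ℕ.≤? n
... | yes R≤n = inj₁ (ℕₚ.≤-trans (s≤s z≤n) (threshold-≥2 T) , every-rainbow n R bound ,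
        λ s 1≤s s<R every → attained s s<R (λ realised → not-every-rainbow n s 1≤s realised every))
... | no R≰n with R ℕ.≟ suc n
...   | yes refl = inj₂ (refl , λ s 1≤s s≤n every →
          attained s (s≤s s≤n) (λ realised → not-every-rainbow n s 1≤s realised every))
...   | no R≢1+n = ⊥-elim (attained (suc n) (ℕₚ.≤∧≢⇒< (ℕₚ.≰⇒> R≰n) (≢-sym R≢1+n))
          (λ realised → ℕₚ.n≮n n (realises-≤ n realised)))

threshold-power : ∀ p {{_ : NonZero p}} {ρ} α → Threshold p ρ →
  Σ ℕ λ R → Threshold (p ^ α) R × (+ R ≡ + 2 + + α * (+ ρ - + 2))
threshold-power p zero Tp = 2 , threshold-1 , refl
threshold-power p {{p≢0}} {ρ} (suc α) Tp with threshold-power p α Tp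
... | (R′ , T′ , R′≡) with threshold-product′ p (p ^ α) {{p≢0}} {{ℕₚ.m^n≢0 p α}} Tp T′
...   | (R , T , R≡) = R , T , (begin
  + R                                   ≡⟨ R≡ ⟩
  + ρ + + R′ - + 2                      ≡⟨ cong (λ r → + ρ + r - + 2) R′≡ ⟩
  + ρ + (+ 2 + + α * (+ ρ - + 2)) - + 2 ≡⟨ regroup (+ ρ) (+ α) ⟩
  + 2 + (+ 1 + + α) * (+ ρ - + 2)       ≡⟨ cong (λ a → + 2 + a * (+ ρ - + 2)) (ℤₚ.pos-+ 1 α) ⟨
  + 2 + + suc α * (+ ρ - + 2)           ∎)
  where
  open ≡-Reasoning
  regroup : ∀ ρ α → ρ + (+ 2 + α * (ρ - + 2)) - + 2 ≡ + 2 + (+ 1 + α) * (ρ - + 2)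
  regroup = solve-∀

expand : List (ℕ × ℕ) → ℕ
expand fs = product (map (λ pa → proj₁ pa ^ proj₂ pa) fs)

rbFormula-∷ : ∀ p α fs ρ ρs →
  rbFormula ((p , α) ∷ fs) (ρ ∷ ρs) ≡ (+ 2 + + α * (+ ρ - + 2)) + rbFormula fs ρs - + 2
rbFormula-∷ p α fs ρ ρs = regroup (+ α * (+ ρ - + 2)) _
  where
  regroup : ∀ a x → + 2 + (a + x) ≡ (+ 2 + a) + (+ 2 + x) - + 2
  regroup = solve-∀

-- The formula for any factorisation into powers of nonzero numbers.
threshold-expand : ∀ fs ρs → All (λ pa → NonZero (proj₁ pa)) fs →
  Pointwise (λ pa ρ → IsRb (proj₁ pa) (+ 1) ρ) fs ρs →
  Σ ℕ λ R → NonZero (expand fs) × Threshold (expand fs) R × (+ R ≡ rbFormula fs ρs)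
threshold-expand [] [] [] [] = 2 , _ , threshold-1 , refl
threshold-expand ((p , α) ∷ fs) (ρ ∷ ρs) (p≢0 ∷ nonzero) (rb ∷ rbs)
  with threshold-expand fs ρs nonzero rbs
... | (R′ , rest≢0 , T′ , R′≡) with threshold-power p {{p≢0}} α (isRb⇒threshold p {{p≢0}} ρ rb)
... | (Rα , Tα , Rα≡) with threshold-product′ (p ^ α) (expand fs) {{ℕₚ.m^n≢0 p α {{p≢0}}}} {{rest≢0}} Tα T′
... | (R , T , R≡) =
  R , ℕₚ.m*n≢0 (p ^ α) (expand fs) {{ℕₚ.m^n≢0 p α {{p≢0}}}} {{rest≢0}} , T ,
  trans R≡ (trans (cong₂ (λ a b → a + b - + 2) Rα≡ R′≡) (sym (rbFormula-∷ p α fs ρ ρs)))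

theorem2 : ∀ (n : ℕ) → 1 ≤ n →
    ∀ (fs : List (ℕ × ℕ)) → IsPrimeFactorization n fs →
    ∀ (ρs : List ℕ) → Pointwise (λ pa ρ → IsRb (proj₁ pa) (+ 1) ρ) fs ρs →
    ∃ λ (r : ℕ) → IsRb n (+ 1) r × (+ r ≡ rbFormula fs ρs)
theorem2 n _ fs (primes , _ , n≡expand) ρs rbs
  with threshold-expand fs ρs (All.map (prime⇒nonZero ∘ proj₁) primes) rbs
... | (R , expand≢0 , T , R≡) =
  R , subst (λ m → IsRb m (+ 1) R) (sym n≡expand) (threshold⇒isRb (expand fs) {{expand≢0}} R T) , R≡
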